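{- Let $G$ be a graph and let $\mathcal{C}$ be a family of pairwise vertex-disjoint copies of $K_4$ in $G$ (each a set of 4 pairwise adjacent vertices), with $V(\mathcal{C})$ the union of these sets. Let $\rho \geq 1$ and let $S$ be a $\rho$-approximate solution for \textsc{Bipartization} on $G - V(\mathcal{C})$, i.e., $S \subseteq V(G)\setminus V(\mathcal{C})$, $(G - V(\mathcal{C})) - S$ is bipartite, and $|S|$ is at most $\rho$ times the minimum size of an odd cycle transversal of $G - V(\mathcal{C})$. Then $S \cup V(\mathcal{C})$ is a $\max\{2,\rho\}$-approximate solution for \textsc{Bipartization} on $G$, i.e., $G - (S\cup V(\mathcal{C}))$ is bipartite and $|S \cup V(\mathcal{C})| \leq \max\{2,\rho\}$ times the minimum size of an odd cycle transversal of $G$.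
   Context: An odd cycle transversal (OCT) of a graph $H$ is a set $X\subseteq V(H)$ such that $H-X$ (the subgraph induced by $V(H)\setminus X$) is bipartite. \textsc{Bipartization} asks for a minimum-size OCT.
   Formalization: The approximation ratio ρ ranges over the rationals, so $\max\{2,\rho\}$ is also taken in the rationals. -}

module Defs where

open import Data.Nat using (ℕ)
open import Data.Fin using (Fin)
open import Data.Fin.Subset using (Subset; _∈_; _∉_; _⊆_; _∪_; _─_; ⋃; ∣_∣; _∩_; Empty)
open import Data.Bool using (Bool)
open import Data.List using (List)
open import Data.List.Relation.Unary.All using (All)
open import Data.List.Relation.Unary.AllPairs using (AllPairs)
open import Data.Product using (Σ; _×_)
open import Data.Integer using (+_)
open import Data.Rational using (ℚ; _/_; _≤_; _*_; _⊔_)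
open import Relation.Binary.PropositionalEquality using (_≡_; _≢_)
open import Relation.Nullary using (¬_)

record Graph (n : ℕ) : Set₁ where
  field
    Adj   : Fin n → Fin n → Set
    sym   : ∀ {u v} → Adj u v → Adj v u
    irrefl : ∀ {u} → ¬ Adj u u
open Graph public

BipartiteOn : ∀ {n} → Graph n → Subset n → Set
BipartiteOn {n} G U =
  Σ (Fin n → Bool) λ c → ∀ u v → u ∈ U → v ∈ U → Adj G u v → c u ≢ c v

IsOCT : ∀ {n} → Graph n → Subset n → Subset n → Set
IsOCT G U X = X ⊆ U × BipartiteOn G (U ─ X)

IsMinOCTSize : ∀ {n} → Graph n → Subset n → ℕ → Set
IsMinOCTSize {n} G U k =
  Σ (Subset n) (λ X → IsOCT G U X × ∣ X ∣ ≡ k)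
  × (∀ X → IsOCT G U X → k Data.Nat.≤ ∣ X ∣)

IsK4 : ∀ {n} → Graph n → Subset n → Set
IsK4 G K = ∣ K ∣ ≡ 4 × (∀ u v → u ∈ K → v ∈ K → u ≢ v → Adj G u v)

Disjoint : ∀ {n} → Subset n → Subset n → Set
Disjoint A B = Empty (A ∩ B)

IsDisjointK4Family : ∀ {n} → Graph n → List (Subset n) → Set
IsDisjointK4Family G 𝒞 = All (IsK4 G) 𝒞 × AllPairs Disjoint 𝒞

ℕtoℚ : ℕ → ℚ
ℕtoℚ k = + k / 1

IsApproxOCT : ∀ {n} → Graph n → Subset n → ℚ → Subset n → Set
IsApproxOCT G U ρ S =
  IsOCT G U S × (∀ opt → IsMinOCTSize G U opt → ℕtoℚ ∣ S ∣ ≤ ρ * ℕtoℚ opt)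

{-# OPTIONS --safe #-}
-- Let X be a minimum odd cycle transversal of G. A clique in a bipartite graph has at most
-- two vertices, so X contains at least two vertices of every K4 in 𝒞; and X ∖ V(𝒞) is an odd
-- cycle transversal of G − V(𝒞). Since the K4s are disjoint, opt(G) ≥ opt(G − V(𝒞)) + 2|𝒞|.
-- On the other hand |S ∪ V(𝒞)| ≤ ρ·opt(G − V(𝒞)) + 2·(2|𝒞|) ≤ max{2, ρ}·opt(G).
module Submission where

open import Defs
open import Data.Nat using (ℕ)
open import Data.Fin.Subset using (Subset; ⋃; _∪_; _─_; ⊤)
open import Data.List using (List)
open import Data.Integer using (+_)
open import Data.Rational using (ℚ; _≤_; _⊔_; 1ℚ; _/_)

open import Data.Bool using (Bool; not)
open import Data.Bool.Properties using (¬-not)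
open import Data.Empty using (⊥-elim)
open import Data.Fin using (Fin; zero; suc; _≟_)
open import Data.Fin.Properties using (suc-injective; 0≢1+n)
open import Data.Fin.Subset using (_∈_; _∉_; _⊆_; _∩_; ∣_∣; ⊥; inside; outside)
open import Data.Fin.Subset.Properties
  using (⊆⊤; ∉⊥; x∈p∩q⁺; x∈p∩q⁻; x∈p∪q⁻; x∈p∧x∉q⇒x∈p─q; p─q⊆p; p─q─r≡p─q∪r; p─q─r≡p─r─q;
         ∩-comm; drop-∷-Empty; Empty-unique; ∣⊥∣≡0)
open import Data.List using ([]; _∷_; length)
open import Data.List.Relation.Unary.All using (All; []; _∷_)
import Data.List.Relation.Unary.All as All
open import Data.List.Relation.Unary.AllPairs using (AllPairs; []; _∷_)
open import Data.Vec using ([]; _∷_; here; there)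
open import Data.Nat as ℕ using (_+_; _*_; _<_; z≤n; s≤s)
import Data.Nat.Properties as ℕ
open import Data.Nat.Induction using (<-rec)
import Data.Nat.Coprimality as Coprime
import Data.Integer as ℤ
import Data.Integer.Properties as ℤ
open import Data.Rational as ℚ using (mkℚ; NonNegative; nonNegative)
open import Data.Rational.Properties as ℚ
  using (normalize-coprime; normalize-nonNeg; p≤p⊔q; p≤q⊔p; ⊔-comm; *-monoʳ-≤-nonNeg;
         *-monoˡ-≤-nonNeg)
open import Data.Product using (∃; _×_; _,_; proj₁; proj₂)
open import Data.Sum using (inj₁; inj₂)
open import Function using (_∘_)
open import Relation.Nullary using (¬_)
open import Relation.Nullary.Decidable using (decidable-stable)
open import Relation.Nullary.Negation using (¬¬-map)
open import Relation.Binary.PropositionalEquality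
  using (_≡_; _≢_; refl; trans; cong; cong₂; subst; subst₂; module ≡-Reasoning)
import Relation.Binary.PropositionalEquality as ≡

private variable
  n : ℕ

¬¬-least : ∀ {p} {P : ℕ → Set p} {m} → P m →
           ¬ ¬ ∃ λ k → P k × (∀ {j} → P j → k ℕ.≤ j)
¬¬-least {P = P} {m} = <-rec (λ m → P m → ¬ ¬ Least) step m
  where
  Least = ∃ λ k → P k × (∀ {j} → P j → k ℕ.≤ j)
  step : ∀ m → (∀ {j} → j < m → P j → ¬ ¬ Least) → P m → ¬ ¬ Least
  step m smaller pm ¬least =
    ¬least (m , pm , λ {j} pj → ℕ.≮⇒≥ λ j<m → smaller j<m pj ¬least)

x∈p─q⁻ : ∀ (p q : Subset n) {x} → x ∈ p ─ q → x ∈ p × x ∉ q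
x∈p─q⁻ (inside  ∷ p) (outside ∷ q) here = here , λ ()
x∈p─q⁻ (outside ∷ p) (inside  ∷ q) {zero} ()
x∈p─q⁻ (outside ∷ p) (outside ∷ q) {zero} ()
x∈p─q⁻ (_ ∷ p) (_ ∷ q) (there x∈p─q) =
  let x∈p , x∉q = x∈p─q⁻ p q x∈p─q in there x∈p , λ { (there x∈q) → x∉q x∈q }

─-monoˡ : ∀ {p q r : Subset n} → p ⊆ q → p ─ r ⊆ q ─ r
─-monoˡ {p = p} {r = r} p⊆q x∈p─r =
  let x∈p , x∉r = x∈p─q⁻ p r x∈p─r in x∈p∧x∉q⇒x∈p─q (p⊆q x∈p) x∉r

∣p∪q∣≤∣p∣+∣q∣ : ∀ (p q : Subset n) → ∣ p ∪ q ∣ ℕ.≤ ∣ p ∣ + ∣ q ∣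
∣p∪q∣≤∣p∣+∣q∣ []            []            = z≤n
∣p∪q∣≤∣p∣+∣q∣ (inside  ∷ p) (inside  ∷ q) =
  s≤s (ℕ.≤-trans (∣p∪q∣≤∣p∣+∣q∣ p q) (ℕ.+-monoʳ-≤ ∣ p ∣ (ℕ.n≤1+n ∣ q ∣)))
∣p∪q∣≤∣p∣+∣q∣ (inside  ∷ p) (outside ∷ q) = s≤s (∣p∪q∣≤∣p∣+∣q∣ p q)
∣p∪q∣≤∣p∣+∣q∣ (outside ∷ p) (inside  ∷ q) =
  ℕ.≤-trans (s≤s (∣p∪q∣≤∣p∣+∣q∣ p q)) (ℕ.≤-reflexive (≡.sym (ℕ.+-suc ∣ p ∣ ∣ q ∣)))
∣p∪q∣≤∣p∣+∣q∣ (outside ∷ p) (outside ∷ q) = ∣p∪q∣≤∣p∣+∣q∣ p q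

∣p∣≡∣p∩q∣+∣p─q∣ : ∀ (p q : Subset n) → ∣ p ∣ ≡ ∣ p ∩ q ∣ + ∣ p ─ q ∣
∣p∣≡∣p∩q∣+∣p─q∣ []            []            = refl
∣p∣≡∣p∩q∣+∣p─q∣ (inside  ∷ p) (inside  ∷ q) = cong ℕ.suc (∣p∣≡∣p∩q∣+∣p─q∣ p q)
∣p∣≡∣p∩q∣+∣p─q∣ (inside  ∷ p) (outside ∷ q) =
  trans (cong ℕ.suc (∣p∣≡∣p∩q∣+∣p─q∣ p q)) (≡.sym (ℕ.+-suc _ _))
∣p∣≡∣p∩q∣+∣p─q∣ (outside ∷ p) (inside  ∷ q) = ∣p∣≡∣p∩q∣+∣p─q∣ p q
∣p∣≡∣p∩q∣+∣p─q∣ (outside ∷ p) (outside ∷ q) = ∣p∣≡∣p∩q∣+∣p─q∣ p q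

∣p∩[q∪r]∣≡∣p∩q∣+∣p∩r∣ : ∀ (p q r : Subset n) → Disjoint q r →
                         ∣ p ∩ (q ∪ r) ∣ ≡ ∣ p ∩ q ∣ + ∣ p ∩ r ∣
∣p∩[q∪r]∣≡∣p∩q∣+∣p∩r∣ []            []            []            _   = refl
∣p∩[q∪r]∣≡∣p∩q∣+∣p∩r∣ (outside ∷ p) (_       ∷ q) (_       ∷ r) q#r =
  ∣p∩[q∪r]∣≡∣p∩q∣+∣p∩r∣ p q r (drop-∷-Empty q#r)
∣p∩[q∪r]∣≡∣p∩q∣+∣p∩r∣ (inside  ∷ p) (inside  ∷ q) (inside  ∷ r) q#r =
  ⊥-elim (q#r (zero , here))
∣p∩[q∪r]∣≡∣p∩q∣+∣p∩r∣ (inside  ∷ p) (inside  ∷ q) (outside ∷ r) q#r =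
  cong ℕ.suc (∣p∩[q∪r]∣≡∣p∩q∣+∣p∩r∣ p q r (drop-∷-Empty q#r))
∣p∩[q∪r]∣≡∣p∩q∣+∣p∩r∣ (inside  ∷ p) (outside ∷ q) (inside  ∷ r) q#r =
  trans (cong ℕ.suc (∣p∩[q∪r]∣≡∣p∩q∣+∣p∩r∣ p q r (drop-∷-Empty q#r))) (≡.sym (ℕ.+-suc _ _))
∣p∩[q∪r]∣≡∣p∩q∣+∣p∩r∣ (inside  ∷ p) (outside ∷ q) (outside ∷ r) q#r =
  ∣p∩[q∪r]∣≡∣p∩q∣+∣p∩r∣ p q r (drop-∷-Empty q#r)

Disjoint-⋃ : ∀ {p : Subset n} {qs} → All (Disjoint p) qs → Disjoint p (⋃ qs)
Disjoint-⋃ {p = p} []         (x , x∈p∩⊥)  = ∉⊥ (proj₂ (x∈p∩q⁻ p ⊥ x∈p∩⊥))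
Disjoint-⋃ {p = p} {q ∷ qs} (p#q ∷ p#qs) (x , x∈p∩[q∪⋃qs]) with x∈p∩q⁻ p (q ∪ ⋃ qs) x∈p∩[q∪⋃qs]
... | x∈p , x∈q∪⋃qs with x∈p∪q⁻ q (⋃ qs) x∈q∪⋃qs
...   | inj₁ x∈q   = p#q (x , x∈p∩q⁺ (x∈p , x∈q))
...   | inj₂ x∈⋃qs = Disjoint-⋃ p#qs (x , x∈p∩q⁺ (x∈p , x∈⋃qs))

∣⋃ps∣≤m*length : ∀ {m} {ps : List (Subset n)} → All (λ p → ∣ p ∣ ℕ.≤ m) ps →
                 ∣ ⋃ ps ∣ ℕ.≤ m * length ps
∣⋃ps∣≤m*length {n} {m} {[]}     []               =
  ℕ.≤-reflexive (trans (∣⊥∣≡0 n) (≡.sym (ℕ.*-zeroʳ m)))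
∣⋃ps∣≤m*length {n} {m} {p ∷ ps} (∣p∣≤m ∷ ∣ps∣≤m) = begin
  ∣ p ∪ ⋃ ps ∣        ≤⟨ ∣p∪q∣≤∣p∣+∣q∣ p (⋃ ps) ⟩
  ∣ p ∣ + ∣ ⋃ ps ∣    ≤⟨ ℕ.+-mono-≤ ∣p∣≤m (∣⋃ps∣≤m*length ∣ps∣≤m) ⟩
  m + m * length ps   ≡⟨ ℕ.*-suc m (length ps) ⟨
  m * length (p ∷ ps) ∎
  where open ℕ.≤-Reasoning

m*length≤∣p∩⋃qs∣ : ∀ {m} (p : Subset n) {qs} → AllPairs Disjoint qs →
                   All (λ q → m ℕ.≤ ∣ p ∩ q ∣) qs → m * length qs ℕ.≤ ∣ p ∩ ⋃ qs ∣
m*length≤∣p∩⋃qs∣ {m = m} p {[]}     []                []                    =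
  ℕ.≤-trans (ℕ.≤-reflexive (ℕ.*-zeroʳ m)) z≤n
m*length≤∣p∩⋃qs∣ {m = m} p {q ∷ qs} (q#qs ∷ disjoint) (m≤∣p∩q∣ ∷ m≤∣p∩qs∣) = begin
  m * length (q ∷ qs)         ≡⟨ ℕ.*-suc m (length qs) ⟩
  m + m * length qs           ≤⟨ ℕ.+-mono-≤ m≤∣p∩q∣ (m*length≤∣p∩⋃qs∣ p disjoint m≤∣p∩qs∣) ⟩
  ∣ p ∩ q ∣ + ∣ p ∩ ⋃ qs ∣     ≡⟨ ∣p∩[q∪r]∣≡∣p∩q∣+∣p∩r∣ p q (⋃ qs) (Disjoint-⋃ q#qs) ⟨
  ∣ p ∩ (q ∪ ⋃ qs) ∣          ∎
  where open ℕ.≤-Reasoning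

subsingleton⇒∣p∣≤1 : ∀ {p : Subset n} → (∀ {x y} → x ∈ p → y ∈ p → x ≡ y) → ∣ p ∣ ℕ.≤ 1
subsingleton⇒∣p∣≤1 {_}     {[]}          _    = z≤n
subsingleton⇒∣p∣≤1 {_}     {outside ∷ p} same =
  subsingleton⇒∣p∣≤1 λ x∈p y∈p → suc-injective (same (there x∈p) (there y∈p))
subsingleton⇒∣p∣≤1 {ℕ.suc n} {inside ∷ p} same = s≤s (ℕ.≤-reflexive ∣p∣≡0)
  where
  ∣p∣≡0 : ∣ p ∣ ≡ 0
  ∣p∣≡0 = trans (cong ∣_∣ (Empty-unique λ (y , y∈p) → 0≢1+n (same here (there y∈p))))
                (∣⊥∣≡0 n)

Rainbow : (Fin n → Bool) → Subset n → Set
Rainbow c p = ∀ {x y} → x ∈ p → y ∈ p → x ≢ y → c x ≢ c y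

rainbow⇒∣p∣≤2 : ∀ (c : Fin n → Bool) {p} → Rainbow c p → ∣ p ∣ ℕ.≤ 2
rainbow⇒∣p∣≤2 c {[]}          _       = z≤n
rainbow⇒∣p∣≤2 c {outside ∷ p} rainbow =
  rainbow⇒∣p∣≤2 (c ∘ suc) λ x∈p y∈p x≢y →
    rainbow (there x∈p) (there y∈p) (x≢y ∘ suc-injective)
rainbow⇒∣p∣≤2 c {inside  ∷ p} rainbow = s≤s (subsingleton⇒∣p∣≤1 same)
  where
  other : ∀ {x} → x ∈ p → c (suc x) ≡ not (c zero)
  other x∈p = ¬-not (rainbow (there x∈p) here λ ())
  same : ∀ {x y} → x ∈ p → y ∈ p → x ≡ y
  same x∈p y∈p = decidable-stable (_ ≟ _) λ x≢y →
    rainbow (there x∈p) (there y∈p) (x≢y ∘ suc-injective)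
            (trans (other x∈p) (≡.sym (other y∈p)))

ℕtoℚ≡mkℚ : ∀ k → ℕtoℚ k ≡ mkℚ (+ k) 0 (Coprime.sym (Coprime.1-coprimeTo k))
ℕtoℚ≡mkℚ k = normalize-coprime (Coprime.sym (Coprime.1-coprimeTo k))

-- In ℕtoℚ-+ and ℕtoℚ-* the middle term is what ℚ._+_ and ℚ._*_ compute on fractions with
-- denominator 1.
ℕtoℚ-+ : ∀ a b → ℕtoℚ (a + b) ≡ ℕtoℚ a ℚ.+ ℕtoℚ b
ℕtoℚ-+ a b = begin
  + (a + b) / 1                       ≡⟨ cong (_/ 1) (cong₂ ℤ._+_ (ℤ.*-identityʳ (+ a))
                                                                    (ℤ.*-identityʳ (+ b))) ⟨
  (+ a ℤ.* + 1 ℤ.+ + b ℤ.* + 1) / 1   ≡⟨ cong₂ ℚ._+_ (ℕtoℚ≡mkℚ a) (ℕtoℚ≡mkℚ b) ⟨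
  ℕtoℚ a ℚ.+ ℕtoℚ b                   ∎
  where open ≡-Reasoning

ℕtoℚ-* : ∀ a b → ℕtoℚ (a * b) ≡ ℕtoℚ a ℚ.* ℕtoℚ b
ℕtoℚ-* a b = begin
  + (a * b) / 1          ≡⟨ cong (_/ 1) (ℤ.pos-* a b) ⟩
  (+ a ℤ.* + b) / 1      ≡⟨ cong₂ ℚ._*_ (ℕtoℚ≡mkℚ a) (ℕtoℚ≡mkℚ b) ⟨
  ℕtoℚ a ℚ.* ℕtoℚ b      ∎
  where open ≡-Reasoning

ℕtoℚ-mono-≤ : ∀ {a b} → a ℕ.≤ b → ℕtoℚ a ≤ ℕtoℚ b
ℕtoℚ-mono-≤ {a} {b} a≤b = subst₂ _≤_ (≡.sym (ℕtoℚ≡mkℚ a)) (≡.sym (ℕtoℚ≡mkℚ b))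
  (ℚ.*≤* (ℤ.*-monoʳ-≤-nonNeg (+ 1) (ℤ.+≤+ a≤b)))

ℕtoℚ-nonNeg : ∀ k → NonNegative (ℕtoℚ k)
ℕtoℚ-nonNeg k = normalize-nonNeg k 1

+-mono-≤-scaled : ∀ {ρ σ x y z w} .{{_ : NonNegative y}} .{{_ : NonNegative w}} →
                  x ≤ ρ ℚ.* y → z ≤ σ ℚ.* w → x ℚ.+ z ≤ (ρ ⊔ σ) ℚ.* (y ℚ.+ w)
+-mono-≤-scaled {ρ} {σ} {x} {y} {z} {w} x≤ρy z≤σw = begin
  x ℚ.+ z                               ≤⟨ ℚ.+-mono-≤ x≤ρy z≤σw ⟩
  ρ ℚ.* y ℚ.+ σ ℚ.* w                   ≤⟨ ℚ.+-mono-≤ (*-monoʳ-≤-nonNeg y (p≤p⊔q ρ σ))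
                                                      (*-monoʳ-≤-nonNeg w (p≤q⊔p ρ σ)) ⟩
  (ρ ⊔ σ) ℚ.* y ℚ.+ (ρ ⊔ σ) ℚ.* w       ≡⟨ ℚ.*-distribˡ-+ (ρ ⊔ σ) y w ⟨
  (ρ ⊔ σ) ℚ.* (y ℚ.+ w)                 ∎
  where open ℚ.≤-Reasoning

ℕtoℚ-+-2*-≤-⊔ : ∀ {ρ s b c o} → ℕtoℚ s ≤ ρ ℚ.* ℕtoℚ b → b + c ℕ.≤ o →
                ℕtoℚ (s + 2 * c) ≤ (ℕtoℚ 2 ⊔ ρ) ℚ.* ℕtoℚ o
ℕtoℚ-+-2*-≤-⊔ {ρ} {s} {b} {c} {o} s≤ρb b+c≤o = begin
  ℕtoℚ (s + 2 * c)                          ≡⟨ trans (ℕtoℚ-+ s (2 * c))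
                                                     (cong (ℕtoℚ s ℚ.+_) (ℕtoℚ-* 2 c)) ⟩
  ℕtoℚ s ℚ.+ ℕtoℚ 2 ℚ.* ℕtoℚ c              ≤⟨ +-mono-≤-scaled {ρ = ρ} {σ = ℕtoℚ 2}
                                                 {y = ℕtoℚ b} {w = ℕtoℚ c}
                                                 {{ℕtoℚ-nonNeg b}} {{ℕtoℚ-nonNeg c}} s≤ρb ℚ.≤-refl ⟩
  (ρ ⊔ ℕtoℚ 2) ℚ.* (ℕtoℚ b ℚ.+ ℕtoℚ c)      ≡⟨ cong₂ ℚ._*_ (⊔-comm (ℕtoℚ 2) ρ) (ℕtoℚ-+ b c) ⟨
  (ℕtoℚ 2 ⊔ ρ) ℚ.* ℕtoℚ (b + c)             ≤⟨ *-monoˡ-≤-nonNeg (ℕtoℚ 2 ⊔ ρ) {{2⊔ρ-nonNeg}}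
                                                 (ℕtoℚ-mono-≤ b+c≤o) ⟩
  (ℕtoℚ 2 ⊔ ρ) ℚ.* ℕtoℚ o                   ∎
  where
  open ℚ.≤-Reasoning
  2⊔ρ-nonNeg : NonNegative (ℕtoℚ 2 ⊔ ρ)
  2⊔ρ-nonNeg = nonNegative (ℚ.≤-trans (ℕtoℚ-mono-≤ {0} {2} z≤n) (p≤p⊔q (ℕtoℚ 2) ρ))

IsClique : Graph n → Subset n → Set
IsClique G K = ∀ u v → u ∈ K → v ∈ K → u ≢ v → Adj G u v

BipartiteOn-anti-mono : ∀ {G : Graph n} {U V} → V ⊆ U → BipartiteOn G U → BipartiteOn G V
BipartiteOn-anti-mono V⊆U (c , proper) =
  c , λ u v u∈V v∈V → proper u v (V⊆U u∈V) (V⊆U v∈V)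

IsOCT-─ : ∀ {G : Graph n} {U X} T → IsOCT G U X → IsOCT G (U ─ T) (X ─ T)
IsOCT-─ {G = G} {U} {X} T (X⊆U , bipartite) =
  ─-monoˡ {r = T} X⊆U , BipartiteOn-anti-mono {G = G} ⊆U─X bipartite
  where
  ⊆U─X : U ─ T ─ (X ─ T) ⊆ U ─ X
  ⊆U─X x∈ =
    let x∈U─T , x∉X─T = x∈p─q⁻ (U ─ T) (X ─ T) x∈
        x∈U   , x∉T   = x∈p─q⁻ U T x∈U─T
    in x∈p∧x∉q⇒x∈p─q x∈U λ x∈X → x∉X─T (x∈p∧x∉q⇒x∈p─q x∈X x∉T)

IsOCT-∪ : ∀ {G : Graph n} {U S T} → T ⊆ U → IsOCT G (U ─ T) S → IsOCT G U (S ∪ T)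
IsOCT-∪ {G = G} {U} {S} {T} T⊆U (S⊆U─T , bipartite) =
  S∪T⊆U , subst (BipartiteOn G) U─T─S≡U─[S∪T] bipartite
  where
  S∪T⊆U : S ∪ T ⊆ U
  S∪T⊆U x∈S∪T with x∈p∪q⁻ S T x∈S∪T
  ... | inj₁ x∈S = p─q⊆p U T (S⊆U─T x∈S)
  ... | inj₂ x∈T = T⊆U x∈T
  U─T─S≡U─[S∪T] : U ─ T ─ S ≡ U ─ (S ∪ T)
  U─T─S≡U─[S∪T] = trans (p─q─r≡p─r─q U T S) (p─q─r≡p─q∪r U S T)

clique⇒∣K─X∣≤2 : ∀ {G : Graph n} {K X} → IsClique G K → BipartiteOn G (⊤ ─ X) → ∣ K ─ X ∣ ℕ.≤ 2
clique⇒∣K─X∣≤2 {K = K} {X} clique (c , proper) = rainbow⇒∣p∣≤2 c λ {x} {y} x∈ y∈ x≢y →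
  proper x y (─-monoˡ ⊆⊤ x∈) (─-monoˡ ⊆⊤ y∈) (clique x y (p─q⊆p K X x∈) (p─q⊆p K X y∈) x≢y)

K4⇒2≤∣X∩K∣ : ∀ {G : Graph n} {K X} → IsK4 G K → BipartiteOn G (⊤ ─ X) → 2 ℕ.≤ ∣ X ∩ K ∣
K4⇒2≤∣X∩K∣ {G = G} {K} {X} (∣K∣≡4 , clique) bipartite = ℕ.+-cancelʳ-≤ 2 2 ∣ X ∩ K ∣ (begin
  4                     ≡⟨ ∣K∣≡4 ⟨
  ∣ K ∣                 ≡⟨ ∣p∣≡∣p∩q∣+∣p─q∣ K X ⟩
  ∣ K ∩ X ∣ + ∣ K ─ X ∣ ≤⟨ ℕ.+-mono-≤ (ℕ.≤-reflexive (cong ∣_∣ (∩-comm K X)))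
                                     (clique⇒∣K─X∣≤2 {G = G} clique bipartite) ⟩
  ∣ X ∩ K ∣ + 2         ∎)
  where open ℕ.≤-Reasoning

-- Adj is not assumed decidable, so a minimum odd cycle transversal exists only up to double
-- negation; this suffices because the approximation bound to be proved is a decidable inequality.
¬¬-minOCTSize : ∀ {G : Graph n} {U X} → IsOCT G U X → ¬ ¬ ∃ (IsMinOCTSize G U)
¬¬-minOCTSize X-oct = ¬¬-map
  (λ (k , smallest , least) → k , smallest , λ Y Y-oct → least (Y , Y-oct , refl))
  (¬¬-least (_ , X-oct , refl))

K4-packing-lower-bound : ∀ {G : Graph n} {𝒞 b X} → IsDisjointK4Family G 𝒞 →
                         IsMinOCTSize G (⊤ ─ ⋃ 𝒞) b → IsOCT G ⊤ X → b + 2 * length 𝒞 ℕ.≤ ∣ X ∣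
K4-packing-lower-bound {G = G} {𝒞} {b} {X} (K4s , disjoint) (_ , minimal) X-oct@(_ , bipartite) =
  begin
  b + 2 * length 𝒞                ≤⟨ ℕ.+-mono-≤ (minimal _ (IsOCT-─ {G = G} (⋃ 𝒞) X-oct))
                                       (m*length≤∣p∩⋃qs∣ X disjoint
                                         (All.map (λ K4 → K4⇒2≤∣X∩K∣ {G = G} K4 bipartite) K4s)) ⟩
  ∣ X ─ ⋃ 𝒞 ∣ + ∣ X ∩ ⋃ 𝒞 ∣        ≡⟨ ℕ.+-comm ∣ X ─ ⋃ 𝒞 ∣ _ ⟩
  ∣ X ∩ ⋃ 𝒞 ∣ + ∣ X ─ ⋃ 𝒞 ∣        ≡⟨ ∣p∣≡∣p∩q∣+∣p─q∣ X (⋃ 𝒞) ⟨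
  ∣ X ∣                           ∎
  where open ℕ.≤-Reasoning

lemma1 : ∀ {n} (G : Graph n) (𝒞 : List (Subset n)) (ρ : ℚ) (S : Subset n)
    → IsDisjointK4Family G 𝒞
    → 1ℚ ≤ ρ
    → IsApproxOCT G (⊤ ─ ⋃ 𝒞) ρ S
    → IsApproxOCT G ⊤ ((+ 2 / 1) ⊔ ρ) (S ∪ ⋃ 𝒞)
lemma1 G 𝒞 ρ S 𝒞-K4s _ (S-oct , S-approx) = IsOCT-∪ {G = G} ⊆⊤ S-oct , bound
  where
  ∣S∪⋃𝒞∣≤ : ∣ S ∪ ⋃ 𝒞 ∣ ℕ.≤ ∣ S ∣ + 2 * (2 * length 𝒞)
  ∣S∪⋃𝒞∣≤ = ℕ.≤-trans (∣p∪q∣≤∣p∣+∣q∣ S (⋃ 𝒞)) (ℕ.+-monoʳ-≤ ∣ S ∣ (ℕ.≤-trans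
    (∣⋃ps∣≤m*length (All.map (ℕ.≤-reflexive ∘ proj₁) (proj₁ 𝒞-K4s)))
    (ℕ.≤-reflexive (ℕ.*-assoc 2 2 (length 𝒞)))))
  bound : ∀ opt → IsMinOCTSize G ⊤ opt → ℕtoℚ ∣ S ∪ ⋃ 𝒞 ∣ ≤ (ℕtoℚ 2 ⊔ ρ) ℚ.* ℕtoℚ opt
  bound _ ((X , X-oct , refl) , _) =
    decidable-stable (_ ℚ.≤? _) (¬¬-map via-minimum
      (¬¬-minOCTSize {G = G} (IsOCT-─ {G = G} (⋃ 𝒞) X-oct)))
    where
    via-minimum : ∃ (IsMinOCTSize G (⊤ ─ ⋃ 𝒞)) →
                  ℕtoℚ ∣ S ∪ ⋃ 𝒞 ∣ ≤ (ℕtoℚ 2 ⊔ ρ) ℚ.* ℕtoℚ ∣ X ∣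
    via-minimum (b , b-min) = ℚ.≤-trans (ℕtoℚ-mono-≤ ∣S∪⋃𝒞∣≤)
      (ℕtoℚ-+-2*-≤-⊔ {ρ = ρ} {s = ∣ S ∣} {b = b} (S-approx b b-min)
        (K4-packing-lower-bound {G = G} 𝒞-K4s b-min X-oct))
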